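{- Let $a_1,b_1,a_2,b_2,d_1,d_2$ be complex numbers, $c_1,c_2$ nonzero complex numbers, $p_1,p_2$ non-negative integers and $k$ a non-negative integer. Then $$S_{a_1,b_1}^{a_2,b_2,p_2}(p_1,k)=c_1^{ -p_1}c_2^{ -p_2}\sum_{j_1=0}^{p_1}\sum_{j_2=0}^{p_2}\binom{p_1}{j_1}\binom{p_2}{j_2}a_1^{j_1}a_2^{j_2}(b_1c_1-a_1d_1)^{p_1-j_1}(b_2c_2-a_2d_2)^{p_2-j_2}S_{c_1,d_1}^{c_2,d_2,j_2}(j_1,k).$$
   Context: For complex numbers $a_1,b_1,a_2,b_2$, non-negative integers $p_1,p_2$ and a non-negative integer $k$, the generalized Stirling number of the second kind is $$S_{a_1,b_1}^{a_2,b_2,p_2}(p_1,k)=\frac{1}{k!}\sum_{j=0}^{k}(-1)^j\binom{k}{j}\bigl(a_1(k-j)+b_1\bigr)^{p_1}\bigl(a_2(k-j)+b_2\bigr)^{p_2},$$ (equivalently, these are the numbers with $(a_1n+b_1)^{p_1}(a_2n+b_2)^{p_2}=\sum_{k\ge0}k!\,S_{a_1,b_1}^{a_2,b_2,p_2}(p_1,k)\binom nk$); they vanish for $k>p_1+p_2$, and are set to $0$ for $k<0$. Here $0^0=1$. -}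

module Defs where

open import Level using (Level; _⊔_) renaming (suc to lsuc)
open import Data.Nat using (ℕ; zero; suc; _∸_; _!)
open import Data.Nat.Combinatorics using (_C_)
open import Relation.Nullary using (¬_)
open import Algebra.Bundles using (CommutativeRing)

module RingOps {c ℓ : Level} (R : CommutativeRing c ℓ) where
  open CommutativeRing R

  fromℕ : ℕ → Carrier
  fromℕ zero    = 0#
  fromℕ (suc n) = 1# + fromℕ n

  -- powers, with x ^ 0 = 1 (so 0^0 = 1)
  infixr 8 _^_
  _^_ : Carrier → ℕ → Carrier
  x ^ zero  = 1#
  x ^ suc n = x * (x ^ n)

  -- sumTo n f = Σ_{j=0}^{n} f j
  sumTo : ℕ → (ℕ → Carrier) → Carrier
  sumTo zero    f = f 0
  sumTo (suc n) f = sumTo n f + f (suc n)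

-- A field of characteristic zero, presented as a commutative ring together
-- with an inverse operation inverting every nonzero element, in which every
-- positive integer n·1 is nonzero.  ℂ is such a field.
record CharZeroField (c ℓ : Level) : Set (lsuc (c ⊔ ℓ)) where
  field
    commRing : CommutativeRing c ℓ
  open CommutativeRing commRing public
  open RingOps commRing public
  field
    _⁻¹      : Carrier → Carrier
    inverse  : ∀ x → ¬ (x ≈ 0#) → x * (x ⁻¹) ≈ 1#
    charZero : ∀ n → ¬ (fromℕ (suc n) ≈ 0#)

module Stirling {c ℓ : Level} (F : CharZeroField c ℓ) where
  open CharZeroField F

  -- Generalized Stirling number of the second kind S_{a1,b1}^{a2,b2,p2}(p1,k)
  --  = (1/k!) Σ_{j=0}^k (-1)^j C(k,j) (a1(k-j)+b1)^p1 (a2(k-j)+b2)^p2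
  S : (a₁ b₁ a₂ b₂ : Carrier) (p₂ p₁ k : ℕ) → Carrier
  S a₁ b₁ a₂ b₂ p₂ p₁ k =
    (fromℕ (k !)) ⁻¹ *
      sumTo k (λ j → ((- 1#) ^ j) * fromℕ (k C j)
                     * ((a₁ * fromℕ (k ∸ j) + b₁) ^ p₁)
                     * ((a₂ * fromℕ (k ∸ j) + b₂) ^ p₂))

-- S_{a₁,b₁}^{a₂,b₂,p₂}(p₁,k) is the divided difference at the nodes 0, 1, …, k of
-- x ↦ (a₁x+b₁)^p₁ (a₂x+b₂)^p₂, a linear functional of that polynomial.  Writing
-- ax + b = c⁻¹ (a(cx+d) + (bc − ad)) and expanding binomially makes the polynomial a
-- linear combination of the (c₁x+d₁)^j₁ (c₂x+d₂)^j₂, and by linearity each of these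
-- contributes S_{c₁,d₁}^{c₂,d₂,j₂}(j₁,k).

module Submission where

open import Defs
open import Level using (Level)
open import Data.Nat using (ℕ; zero; suc; _∸_; _!)
open import Data.Nat.Combinatorics using (_C_)
open import Data.Fin using (toℕ)
open import Function using (_∘_)
open import Relation.Nullary using (¬_)
import Relation.Binary.PropositionalEquality as ≡
open import Algebra.Bundles using (CommutativeRing)
import Algebra.Solver.Ring.NaturalCoefficients.Default as SemiringSolver
import Algebra.Properties.CommutativeSemigroup as CommutativeSemigroupProperties
import Algebra.Properties.CommutativeSemiring.Binomial as Binomial
import Algebra.Properties.CommutativeSemiring.Exp as ExpProperties
import Algebra.Properties.Semiring.Mult as Mult
import Algebra.Properties.Semiring.Sum as Sum
import Algebra.Properties.AbelianGroup as AbelianGroupProperties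
import Relation.Binary.Reasoning.Setoid as SetoidReasoning

module Summation {c ℓ : Level} (R : CommutativeRing c ℓ) where
  open CommutativeRing R
  open RingOps R
  open Sum semiring using (sum)
  open CommutativeSemigroupProperties +-commutativeSemigroup using (interchange)
  open SemiringSolver commutativeSemiring using (solve; _:=_; _:+_; _:*_)
  open SetoidReasoning setoid

  sumTo-cong : ∀ n {f g : ℕ → Carrier} → (∀ j → f j ≈ g j) → sumTo n f ≈ sumTo n g
  sumTo-cong zero    f≈g = f≈g 0
  sumTo-cong (suc n) f≈g = +-cong (sumTo-cong n f≈g) (f≈g (suc n))

  sumTo-shift : ∀ n (f : ℕ → Carrier) → sumTo (suc n) f ≈ f 0 + sumTo n (f ∘ suc)
  sumTo-shift zero    f = refl
  sumTo-shift (suc n) f = trans (+-congʳ (sumTo-shift n f)) (+-assoc _ _ _)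

  sumTo≈sum : ∀ n (f : ℕ → Carrier) → sumTo n f ≈ sum (f ∘ toℕ {suc n})
  sumTo≈sum zero    f = sym (+-identityʳ (f 0))
  sumTo≈sum (suc n) f = trans (sumTo-shift n f) (+-congˡ (sumTo≈sum n (f ∘ suc)))

  sumTo-distrib-+ : ∀ n (f g : ℕ → Carrier) →
    sumTo n (λ j → f j + g j) ≈ sumTo n f + sumTo n g
  sumTo-distrib-+ zero    f g = refl
  sumTo-distrib-+ (suc n) f g =
    trans (+-congʳ (sumTo-distrib-+ n f g)) (interchange _ _ _ _)

  *-distribˡ-sumTo : ∀ n s (f : ℕ → Carrier) → s * sumTo n f ≈ sumTo n (λ j → s * f j)
  *-distribˡ-sumTo zero    s f = refl
  *-distribˡ-sumTo (suc n) s f = trans (distribˡ s _ _) (+-congʳ (*-distribˡ-sumTo n s f))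

  *-distribʳ-sumTo : ∀ n s (f : ℕ → Carrier) → sumTo n f * s ≈ sumTo n (λ j → f j * s)
  *-distribʳ-sumTo zero    s f = refl
  *-distribʳ-sumTo (suc n) s f = trans (distribʳ s _ _) (+-congʳ (*-distribʳ-sumTo n s f))

  sumTo-comm : ∀ m n (f : ℕ → ℕ → Carrier) →
    sumTo m (λ i → sumTo n (f i)) ≈ sumTo n (λ j → sumTo m (λ i → f i j))
  sumTo-comm zero    n f = refl
  sumTo-comm (suc m) n f =
    trans (+-congʳ (sumTo-comm m n f)) (sym (sumTo-distrib-+ n _ (f (suc m))))

  sumTo-*-sumTo : ∀ m n (f g : ℕ → Carrier) →
    sumTo m f * sumTo n g ≈ sumTo m (λ i → sumTo n (λ j → f i * g j))
  sumTo-*-sumTo m n f g = trans (*-distribʳ-sumTo m _ f)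
    (sumTo-cong m (λ i → *-distribˡ-sumTo n (f i) g))

  combination-*-combination : ∀ m n (s t : Carrier) (α β u v : ℕ → Carrier) →
    (s * sumTo m (λ i → α i * u i)) * (t * sumTo n (λ j → β j * v j)) ≈
      s * t * sumTo m (λ i → sumTo n (λ j → (α i * β j) * (u i * v j)))
  combination-*-combination m n s t α β u v = begin
    (s * sumTo m (λ i → α i * u i)) * (t * sumTo n (λ j → β j * v j))
      ≈⟨ solve 4 (λ s t x y → ((s :* x) :* (t :* y)) := ((s :* t) :* (x :* y))) refl _ _ _ _ ⟩
    s * t * (sumTo m (λ i → α i * u i) * sumTo n (λ j → β j * v j))
      ≈⟨ *-congˡ (sumTo-*-sumTo m n _ _) ⟩
    s * t * sumTo m (λ i → sumTo n (λ j → (α i * u i) * (β j * v j)))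
      ≈⟨ *-congˡ (sumTo-cong m λ i → sumTo-cong n λ j →
           solve 4 (λ a u b v → ((a :* u) :* (b :* v)) := ((a :* b) :* (u :* v))) refl _ _ _ _) ⟩
    s * t * sumTo m (λ i → sumTo n (λ j → (α i * β j) * (u i * v j))) ∎

module Powers {c ℓ : Level} (R : CommutativeRing c ℓ) where
  open CommutativeRing R
  open RingOps R
  open Summation R
  open Sum semiring using (sum; sum-cong-≋)
  open Mult semiring using (_×_)
  open Binomial commutativeSemiring using (theorem; binomialExpansion)
  module Exp = ExpProperties commutativeSemiring
  open SetoidReasoning setoid

  ^≡Exp^ : ∀ x n → x ^ n ≡.≡ x Exp.^ n
  ^≡Exp^ x zero    = ≡.refl
  ^≡Exp^ x (suc n) = ≡.cong (x *_) (^≡Exp^ x n)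

  ^-congˡ : ∀ n {x y} → x ≈ y → x ^ n ≈ y ^ n
  ^-congˡ n {x} {y} x≈y rewrite ^≡Exp^ x n | ^≡Exp^ y n = Exp.^-congˡ n x≈y

  ^-distrib-* : ∀ x y n → (x * y) ^ n ≈ x ^ n * y ^ n
  ^-distrib-* x y n rewrite ^≡Exp^ (x * y) n | ^≡Exp^ x n | ^≡Exp^ y n = Exp.^-distrib-* x y n

  ×≈fromℕ* : ∀ m x → m × x ≈ fromℕ m * x
  ×≈fromℕ* zero    x = sym (zeroˡ x)
  ×≈fromℕ* (suc m) x = begin
    x + m × x               ≈⟨ +-cong (sym (*-identityˡ x)) (×≈fromℕ* m x) ⟩
    1# * x + fromℕ m * x    ≈⟨ distribʳ x 1# (fromℕ m) ⟨
    (1# + fromℕ m) * x      ∎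

  binomial-theorem : ∀ n x y →
    (x + y) ^ n ≈ sumTo n (λ j → fromℕ (n C j) * x ^ j * y ^ (n ∸ j))
  binomial-theorem n x y = begin
    (x + y) ^ n                        ≡⟨ ^≡Exp^ (x + y) n ⟩
    (x + y) Exp.^ n                    ≈⟨ theorem n x y ⟩
    binomialExpansion x y n            ≈⟨ sum-cong-≋ {suc n} (term ∘ toℕ) ⟩
    sum (binomialTerm ∘ toℕ {suc n})   ≈⟨ sumTo≈sum n binomialTerm ⟨
    sumTo n binomialTerm               ∎
    where
    binomialTerm : ℕ → Carrier
    binomialTerm j = fromℕ (n C j) * x ^ j * y ^ (n ∸ j)
    term : ∀ j → (n C j) × (x Exp.^ j * y Exp.^ (n ∸ j)) ≈ binomialTerm j
    term j rewrite ^≡Exp^ x j | ^≡Exp^ y (n ∸ j) = trans (×≈fromℕ* (n C j) _) (sym (*-assoc _ _ _))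

module AffineChange {c ℓ : Level} (F : CharZeroField c ℓ) where
  open CharZeroField F
  open Summation commRing
  open Powers commRing
  open AbelianGroupProperties +-abelianGroup using (//-rightDividesʳ)
  open SemiringSolver commutativeSemiring using (solve; _:=_; _:+_; _:*_)
  open SetoidReasoning setoid

  c*x≈y⇒x≈c⁻¹*y : ∀ {c x y} → ¬ c ≈ 0# → c * x ≈ y → x ≈ c ⁻¹ * y
  c*x≈y⇒x≈c⁻¹*y {c} {x} {y} c≉0 c*x≈y = begin
    x                ≈⟨ *-identityˡ x ⟨
    1# * x           ≈⟨ *-congʳ (trans (*-comm (c ⁻¹) c) (inverse c c≉0)) ⟨
    c ⁻¹ * c * x     ≈⟨ *-assoc (c ⁻¹) c x ⟩
    c ⁻¹ * (c * x)   ≈⟨ *-congˡ c*x≈y ⟩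
    c ⁻¹ * y         ∎

  affine-rebase : ∀ a b c d x →
    c * (a * x + b) ≈ a * (c * x + d) + (b * c - a * d)
  -- a * d is added and removed first, so that only a semiring identity is left to the solver.
  affine-rebase a b c d x = begin
    c * (a * x + b)                       ≈⟨ //-rightDividesʳ (a * d) _ ⟨
    c * (a * x + b) + a * d - a * d       ≈⟨ solve 6 (λ a b c d x e →
      (((c :* ((a :* x) :+ b)) :+ (a :* d)) :+ e) :=
      ((a :* ((c :* x) :+ d)) :+ ((b :* c) :+ e))) refl a b c d x (- (a * d)) ⟩
    a * (c * x + d) + (b * c - a * d)     ∎

  affineCoefficient : (a b c d : Carrier) (n j : ℕ) → Carrier
  affineCoefficient a b c d n j = fromℕ (n C j) * a ^ j * (b * c - a * d) ^ (n ∸ j)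

  affine-power-rebase : ∀ a b c d x n → ¬ c ≈ 0# →
    (a * x + b) ^ n ≈
      (c ⁻¹) ^ n * sumTo n (λ j → affineCoefficient a b c d n j * (c * x + d) ^ j)
  affine-power-rebase a b c d x n c≉0 = begin
    (a * x + b) ^ n                      ≈⟨ ^-congˡ n (c*x≈y⇒x≈c⁻¹*y c≉0 (affine-rebase a b c d x)) ⟩
    (c ⁻¹ * (a * w + e)) ^ n             ≈⟨ ^-distrib-* (c ⁻¹) _ n ⟩
    (c ⁻¹) ^ n * (a * w + e) ^ n         ≈⟨ *-congˡ (binomial-theorem n (a * w) e) ⟩
    (c ⁻¹) ^ n * sumTo n (λ j → fromℕ (n C j) * (a * w) ^ j * e ^ (n ∸ j))
      ≈⟨ *-congˡ (sumTo-cong n regroup) ⟩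
    (c ⁻¹) ^ n * sumTo n (λ j → affineCoefficient a b c d n j * w ^ j) ∎
    where
    w e : Carrier
    w = c * x + d
    e = b * c - a * d
    regroup : ∀ j → fromℕ (n C j) * (a * w) ^ j * e ^ (n ∸ j) ≈ affineCoefficient a b c d n j * w ^ j
    regroup j = trans (*-congʳ (*-congˡ (^-distrib-* a w j)))
      (solve 4 (λ m α ω ε → ((m :* (α :* ω)) :* ε) := (((m :* α) :* ε) :* ω)) refl
        (fromℕ (n C j)) (a ^ j) (w ^ j) (e ^ (n ∸ j)))

module DividedDifference {c ℓ : Level} (F : CharZeroField c ℓ) where
  open CharZeroField F
  open Stirling F
  open Summation commRing
  open CommutativeSemigroupProperties *-commutativeSemigroup using (x∙yz≈y∙xz)
  open SetoidReasoning setoid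

  differenceWeight : ℕ → ℕ → Carrier
  differenceWeight k j = (- 1#) ^ j * fromℕ (k C j)

  dividedDifference : ℕ → (Carrier → Carrier) → Carrier
  dividedDifference k g =
    (fromℕ (k !)) ⁻¹ * sumTo k (λ j → differenceWeight k j * g (fromℕ (k ∸ j)))

  S≈dividedDifference : ∀ a₁ b₁ a₂ b₂ p₂ p₁ k →
    S a₁ b₁ a₂ b₂ p₂ p₁ k ≈ dividedDifference k (λ x → (a₁ * x + b₁) ^ p₁ * (a₂ * x + b₂) ^ p₂)
  S≈dividedDifference a₁ b₁ a₂ b₂ p₂ p₁ k = *-congˡ (sumTo-cong k (λ j → *-assoc _ _ _))

  dividedDifference-cong : ∀ k {g h : Carrier → Carrier} → (∀ x → g x ≈ h x) →
    dividedDifference k g ≈ dividedDifference k h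
  dividedDifference-cong k g≈h = *-congˡ (sumTo-cong k (λ j → *-congˡ (g≈h _)))

  dividedDifference-*ˡ : ∀ k s (g : Carrier → Carrier) →
    dividedDifference k (λ x → s * g x) ≈ s * dividedDifference k g
  dividedDifference-*ˡ k s g = begin
    dividedDifference k (λ x → s * g x)
      ≈⟨ *-congˡ (sumTo-cong k (λ j → x∙yz≈y∙xz _ s _)) ⟩
    (fromℕ (k !)) ⁻¹ * sumTo k (λ j → s * (differenceWeight k j * g (fromℕ (k ∸ j))))
      ≈⟨ *-congˡ (*-distribˡ-sumTo k s _) ⟨
    (fromℕ (k !)) ⁻¹ * (s * sumTo k (λ j → differenceWeight k j * g (fromℕ (k ∸ j))))
      ≈⟨ x∙yz≈y∙xz _ s _ ⟩
    s * dividedDifference k g ∎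

  dividedDifference-sumTo : ∀ k n (g : ℕ → Carrier → Carrier) →
    dividedDifference k (λ x → sumTo n (λ i → g i x)) ≈ sumTo n (λ i → dividedDifference k (g i))
  dividedDifference-sumTo k n g = begin
    dividedDifference k (λ x → sumTo n (λ i → g i x))
      ≈⟨ *-congˡ (sumTo-cong k (λ j → *-distribˡ-sumTo n (differenceWeight k j) _)) ⟩
    (fromℕ (k !)) ⁻¹ * sumTo k (λ j → sumTo n (λ i → differenceWeight k j * g i (fromℕ (k ∸ j))))
      ≈⟨ *-congˡ (sumTo-comm k n _) ⟩
    (fromℕ (k !)) ⁻¹ * sumTo n (λ i → sumTo k (λ j → differenceWeight k j * g i (fromℕ (k ∸ j))))
      ≈⟨ *-distribˡ-sumTo n _ _ ⟩
    sumTo n (λ i → dividedDifference k (g i)) ∎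

  dividedDifference-double-combination : ∀ k m n (γ : ℕ → ℕ → Carrier) (h : ℕ → ℕ → Carrier → Carrier) →
    dividedDifference k (λ x → sumTo m (λ i → sumTo n (λ j → γ i j * h i j x))) ≈
      sumTo m (λ i → sumTo n (λ j → γ i j * dividedDifference k (h i j)))
  dividedDifference-double-combination k m n γ h =
    trans (dividedDifference-sumTo k m (λ i x → sumTo n (λ j → γ i j * h i j x)))
      (sumTo-cong m λ i → trans (dividedDifference-sumTo k n (λ j x → γ i j * h i j x))
        (sumTo-cong n λ j → dividedDifference-*ˡ k (γ i j) (h i j)))

lemma1 : ∀ {c ℓ : Level} (F : CharZeroField c ℓ) →
    let open CharZeroField F in let open Stirling F in
    ∀ (a₁ b₁ a₂ b₂ d₁ d₂ c₁ c₂ : Carrier) → ¬ (c₁ ≈ 0#) → ¬ (c₂ ≈ 0#) →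
    ∀ (p₁ p₂ k : ℕ) →
    S a₁ b₁ a₂ b₂ p₂ p₁ k ≈
      ((c₁ ⁻¹) ^ p₁) * ((c₂ ⁻¹) ^ p₂) *
        sumTo p₁ (λ j₁ → sumTo p₂ (λ j₂ →
          fromℕ (p₁ C j₁) * fromℕ (p₂ C j₂) * (a₁ ^ j₁) * (a₂ ^ j₂)
          * ((b₁ * c₁ - a₁ * d₁) ^ (p₁ ∸ j₁))
          * ((b₂ * c₂ - a₂ * d₂) ^ (p₂ ∸ j₂))
          * S c₁ d₁ c₂ d₂ j₂ j₁ k))
lemma1 F a₁ b₁ a₂ b₂ d₁ d₂ c₁ c₂ c₁≉0 c₂≉0 p₁ p₂ k = begin
  S a₁ b₁ a₂ b₂ p₂ p₁ k
    ≈⟨ S≈dividedDifference a₁ b₁ a₂ b₂ p₂ p₁ k ⟩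
  dividedDifference k (λ x → (a₁ * x + b₁) ^ p₁ * (a₂ * x + b₂) ^ p₂)
    ≈⟨ dividedDifference-cong k rebase ⟩
  dividedDifference k (λ x → c⁻ᵖ * sumTo p₁ (λ j₁ → sumTo p₂ (λ j₂ → γ j₁ j₂ * h j₁ j₂ x)))
    ≈⟨ dividedDifference-*ˡ k c⁻ᵖ (λ x → sumTo p₁ (λ j₁ → sumTo p₂ (λ j₂ → γ j₁ j₂ * h j₁ j₂ x))) ⟩
  c⁻ᵖ * dividedDifference k (λ x → sumTo p₁ (λ j₁ → sumTo p₂ (λ j₂ → γ j₁ j₂ * h j₁ j₂ x)))
    ≈⟨ *-congˡ (dividedDifference-double-combination k p₁ p₂ γ h) ⟩
  c⁻ᵖ * sumTo p₁ (λ j₁ → sumTo p₂ (λ j₂ → γ j₁ j₂ * dividedDifference k (h j₁ j₂)))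
    ≈⟨ *-congˡ (sumTo-cong p₁ λ j₁ → sumTo-cong p₂ λ j₂ →
         trans (*-congˡ (sym (S≈dividedDifference c₁ d₁ c₂ d₂ j₂ j₁ k))) (regroup j₁ j₂ _)) ⟩
  _ ∎
  where
  open CharZeroField F
  open Stirling F
  open Summation commRing
  open AffineChange F
  open DividedDifference F
  open SemiringSolver commutativeSemiring using (solve; _:=_; _:*_)
  open SetoidReasoning setoid
  c⁻ᵖ : Carrier
  c⁻ᵖ = (c₁ ⁻¹) ^ p₁ * (c₂ ⁻¹) ^ p₂
  α₁ α₂ : ℕ → Carrier
  α₁ = affineCoefficient a₁ b₁ c₁ d₁ p₁
  α₂ = affineCoefficient a₂ b₂ c₂ d₂ p₂
  γ : ℕ → ℕ → Carrier
  γ j₁ j₂ = α₁ j₁ * α₂ j₂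
  h : ℕ → ℕ → Carrier → Carrier
  h j₁ j₂ x = (c₁ * x + d₁) ^ j₁ * (c₂ * x + d₂) ^ j₂
  rebase : ∀ x → (a₁ * x + b₁) ^ p₁ * (a₂ * x + b₂) ^ p₂ ≈
    c⁻ᵖ * sumTo p₁ (λ j₁ → sumTo p₂ (λ j₂ → γ j₁ j₂ * h j₁ j₂ x))
  rebase x = trans
    (*-cong (affine-power-rebase a₁ b₁ c₁ d₁ x p₁ c₁≉0) (affine-power-rebase a₂ b₂ c₂ d₂ x p₂ c₂≉0))
    (combination-*-combination p₁ p₂ _ _ α₁ α₂ _ _)
  regroup : ∀ j₁ j₂ s → γ j₁ j₂ * s ≈
    fromℕ (p₁ C j₁) * fromℕ (p₂ C j₂) * (a₁ ^ j₁) * (a₂ ^ j₂)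
      * ((b₁ * c₁ - a₁ * d₁) ^ (p₁ ∸ j₁)) * ((b₂ * c₂ - a₂ * d₂) ^ (p₂ ∸ j₂)) * s
  regroup j₁ j₂ s = solve 7 (λ m₁ m₂ u₁ u₂ v₁ v₂ s →
      ((((m₁ :* u₁) :* v₁) :* ((m₂ :* u₂) :* v₂)) :* s) :=
      ((((((m₁ :* m₂) :* u₁) :* u₂) :* v₁) :* v₂) :* s)) refl
    (fromℕ (p₁ C j₁)) (fromℕ (p₂ C j₂)) (a₁ ^ j₁) (a₂ ^ j₂)
    ((b₁ * c₁ - a₁ * d₁) ^ (p₁ ∸ j₁)) ((b₂ * c₂ - a₂ * d₂) ^ (p₂ ∸ j₂)) s
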